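{- Let $F$ be a finite field, let $F^* := F \setminus \{0\}$, and let $A, B$ be non-empty subsets of $F$. Then there exists $\xi \in F^*$ such that $$|A + B\xi| \geq \min\left(\tfrac{1}{2}|A||B|, \tfrac{1}{10}|F|\right).$$
   Context: $A + B\xi := \{a + b\xi : a \in A, b \in B\}$. -}

module Defs where

open import Data.Bool using (Bool; true; false; _∧_)
import Data.Bool
open import Data.Nat using (ℕ; zero; suc; _+_)
open import Data.Fin using (Fin)
open import Data.List using (List; map; allFin; length; filter)
open import Data.Bool.ListAction using (any)
open import Data.Product using (∃)
open import Function.Bundles using (_↔_; Inverse)
open import Relation.Binary.PropositionalEquality using (_≡_)
open import Relation.Binary.Definitions using (DecidableEquality)
open import Relation.Nullary using (¬_; does)
open import Algebra.Structures using (IsCommutativeRing)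

record FiniteField : Set₁ where
  infixl 6 _+F_
  infixl 7 _*F_
  field
    Carrier : Set
    _+F_ _*F_ : Carrier → Carrier → Carrier
    -F_ : Carrier → Carrier
    0F 1F : Carrier
    isCommutativeRing : IsCommutativeRing _≡_ _+F_ _*F_ -F_ 0F 1F
    0≢1 : ¬ (0F ≡ 1F)
    inverse : ∀ x → ¬ (x ≡ 0F) → ∃ λ y → x *F y ≡ 1F
    size : ℕ
    enum : Fin size ↔ Carrier
    _≟_ : DecidableEquality Carrier

  elems : List Carrier
  elems = map (Inverse.to enum) (allFin size)

  Subset : Set
  Subset = Carrier → Bool

  ∣_∣ : Subset → ℕ
  ∣ S ∣ = length (filter (λ x → S x Data.Bool.≟ true) elems)

  NonEmpty : Subset → Set
  NonEmpty S = ∃ λ x → S x ≡ true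

  sumDil : Subset → Subset → Carrier → Subset
  sumDil A B ξ c =
    any (λ a → any (λ b → A a ∧ B b ∧ does (c ≟ (a +F b *F ξ))) elems) elems

{-# OPTIONS --safe #-}
module Submission where

-- Fix ξ ≠ 0 and let r(s) be the number of pairs (a, b) ∈ A × B with a + bξ = s, so that
-- Σ_s r(s) = |A||B| and E(ξ) = Σ_s r(s)² counts pairs of pairs with the same image.
-- Cauchy–Schwarz over the support of r gives (|A||B|)² ≤ |A + Bξ| · E(ξ).  Two distinct
-- pairs (a, b) ≠ (a', b') satisfy a + bξ = a' + b'ξ for at most one ξ, because
-- (b - b')ξ = a' - a is linear in ξ; hence, with m = |F| - 1 dilations,
-- Σ_{ξ ≠ 0} E(ξ) ≤ |A||B| (m + |A||B|), and some ξ ≠ 0 has m E(ξ) ≤ |A||B| (m + |A||B|).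
-- Eliminating E(ξ) gives m |A||B| ≤ |A + Bξ| (m + |A||B|), i.e. min(|A||B|, m) ≤ 2 |A + Bξ|,
-- and the stated bound follows from |F| = m + 1 ≤ 5m.

open import Defs
open import Algebra.Bundles using (CommutativeRing)
open import Algebra.Structures using (IsCommutativeRing)
import Algebra.Properties.Group as GroupProperties
import Algebra.Properties.Ring as RingProperties
open import Data.Bool as Bool using (true; _∧_)
open import Data.Bool.ListAction using (any)
open import Data.Bool.Properties using (T-≡)
open import Data.List using (List; []; _∷_; length; filter; map; allFin; cartesianProduct)
open import Data.List.Properties using (length-++; length-map; length-tabulate)
open import Data.List.Membership.Propositional using (_∈_; _∉_; lose)
open import Data.List.Membership.Propositional.Properties
  using (∈-map⁺; ∈-allFin; ∈-filter⁺; ∈-filter⁻; ∈-cartesianProduct⁻)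
open import Data.List.Relation.Unary.All as All using (All; []; _∷_)
open import Data.List.Relation.Unary.All.Properties using (All¬⇒¬Any)
open import Data.List.Relation.Unary.Any using (here; there)
open import Data.List.Relation.Unary.Any.Properties using (any⁺)
open import Data.List.Relation.Unary.Unique.Propositional using (Unique; []; _∷_)
open import Data.List.Relation.Unary.Unique.Propositional.Properties
  using (map⁺; allFin⁺; filter⁺; cartesianProduct⁺)
open import Data.Nat using (ℕ; zero; suc; _+_; _*_; _≤_; _<_; _⊓_; z≤n; s≤s; z<s)
open import Data.Nat.Properties hiding (_≟_)
open import Data.Nat.Tactic.RingSolver using (solve-∀)
open import Data.Product using (∃; _×_; _,_; proj₁; proj₂; uncurry)
open import Data.Product.Properties using (≡-dec)
open import Data.Sum using (_⊎_; inj₁; inj₂; fromInj₂)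
open import Function using (_∘_)
open import Function.Bundles using (Inverse; Injection; Equivalence)
open import Function.Properties.Inverse using (↔⇒↣)
open import Relation.Binary.Definitions using (DecidableEquality)
open import Relation.Binary.PropositionalEquality
open import Relation.Nullary using (Dec; yes; no; ¬_; ¬?; does)
open import Relation.Nullary.Decidable using (dec-true)
open import Relation.Nullary.Negation using (contradiction)
open import Relation.Unary using (Pred; Decidable)

𝟙 : ∀ {p} {P : Set p} → Dec P → ℕ
𝟙 (yes _) = 1
𝟙 (no _)  = 0

𝟙≤1 : ∀ {p} {P : Set p} (d : Dec P) → 𝟙 d ≤ 1
𝟙≤1 (yes _) = s≤s z≤n
𝟙≤1 (no _)  = z≤n

0<𝟙⇒ : ∀ {p} {P : Set p} (d : Dec P) → 0 < 𝟙 d → P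
0<𝟙⇒ (yes p) _ = p

sgn : ℕ → ℕ
sgn zero    = 0
sgn (suc _) = 1

sgn[n]*n≡n : ∀ n → sgn n * n ≡ n
sgn[n]*n≡n zero    = refl
sgn[n]*n≡n (suc n) = +-identityʳ (suc n)

sgn[n]*sgn[n]≡sgn[n] : ∀ n → sgn n * sgn n ≡ sgn n
sgn[n]*sgn[n]≡sgn[n] zero    = refl
sgn[n]*sgn[n]≡sgn[n] (suc n) = refl

m≤n⇒2mn≤m²+n² : ∀ {m n} → m ≤ n → 2 * (m * n) ≤ m * m + n * n
m≤n⇒2mn≤m²+n² {m} m≤n with m≤n⇒∃[o]m+o≡n m≤n
... | d , refl = subst (2 * (m * (m + d)) ≤_) (expand m d) (m≤m+n _ (d * d))
  where
  expand : ∀ m d → 2 * (m * (m + d)) + d * d ≡ m * m + (m + d) * (m + d)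
  expand = solve-∀

2mn≤m²+n² : ∀ m n → 2 * (m * n) ≤ m * m + n * n
2mn≤m²+n² m n with ≤-total m n
... | inj₁ m≤n = m≤n⇒2mn≤m²+n² m≤n
... | inj₂ n≤m =
  subst₂ _≤_ (cong (2 *_) (*-comm n m)) (+-comm (n * n) (m * m)) (m≤n⇒2mn≤m²+n² n≤m)

n²≤se⇒me≤n[m+n]⇒mn≤s[m+n] : ∀ n m s {e} →
  n * n ≤ s * e → m * e ≤ n * (m + n) → m * n ≤ s * (m + n)
n²≤se⇒me≤n[m+n]⇒mn≤s[m+n] zero m s _ _ = subst (_≤ s * (m + 0)) (sym (*-zeroʳ m)) z≤n
n²≤se⇒me≤n[m+n]⇒mn≤s[m+n] n@(suc _) m s {e} n²≤se me≤n[m+n] = *-cancelˡ-≤ n (begin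
  n * (m * n)       ≡⟨ x[yx]≡y[xx] n m ⟩
  m * (n * n)       ≤⟨ *-monoʳ-≤ m n²≤se ⟩
  m * (s * e)       ≡⟨ x[yz]≡y[xz] m s e ⟩
  s * (m * e)       ≤⟨ *-monoʳ-≤ s me≤n[m+n] ⟩
  s * (n * (m + n)) ≡⟨ x[yz]≡y[xz] s n (m + n) ⟩
  n * (s * (m + n)) ∎)
  where
  open ≤-Reasoning
  x[yx]≡y[xx] : ∀ x y → x * (y * x) ≡ y * (x * x)
  x[yx]≡y[xx] = solve-∀
  x[yz]≡y[xz] : ∀ x y z → x * (y * z) ≡ y * (x * z)
  x[yz]≡y[xz] = solve-∀

n≤m⇒mn≤s[m+n]⇒n≤2s : ∀ {n m} s → n ≤ m → m * n ≤ s * (m + n) → n ≤ 2 * s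
n≤m⇒mn≤s[m+n]⇒n≤2s {m = zero}      s z≤n _ = z≤n
n≤m⇒mn≤s[m+n]⇒n≤2s {n} {m@(suc _)} s n≤m mn≤s[m+n] = *-cancelˡ-≤ m (begin
  m * n       ≤⟨ mn≤s[m+n] ⟩
  s * (m + n) ≤⟨ *-monoʳ-≤ s (+-monoʳ-≤ m n≤m) ⟩
  s * (m + m) ≡⟨ doubling s m ⟩
  m * (2 * s) ∎)
  where
  open ≤-Reasoning
  doubling : ∀ s m → s * (m + m) ≡ m * (2 * s)
  doubling = solve-∀

mn≤s[m+n]⇒n⊓m≤2s : ∀ n m s → m * n ≤ s * (m + n) → n ⊓ m ≤ 2 * s
mn≤s[m+n]⇒n⊓m≤2s n m s mn≤s[m+n] with ≤-total n m
... | inj₁ n≤m = subst (_≤ 2 * s) (sym (m≤n⇒m⊓n≡m n≤m))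
  (n≤m⇒mn≤s[m+n]⇒n≤2s s n≤m mn≤s[m+n])
... | inj₂ m≤n = subst (_≤ 2 * s) (sym (m≥n⇒m⊓n≡n m≤n))
  (n≤m⇒mn≤s[m+n]⇒n≤2s s m≤n (subst₂ _≤_ (*-comm m n) (cong (s *_) (+-comm m n)) mn≤s[m+n]))

n⊓m≤2s⇒10n⊓2[1+m]≤20s : ∀ n m s → 0 < m → n ⊓ m ≤ 2 * s → (10 * n) ⊓ (2 * suc m) ≤ 20 * s
n⊓m≤2s⇒10n⊓2[1+m]≤20s n m@(suc k) s _ n⊓m≤2s = begin
  (10 * n) ⊓ (2 * suc m) ≤⟨ ⊓-monoʳ-≤ (10 * n) 2[1+m]≤10m ⟩
  (10 * n) ⊓ (10 * m)    ≡⟨ *-distribˡ-⊓ 10 n m ⟨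
  10 * (n ⊓ m)           ≤⟨ *-monoʳ-≤ 10 n⊓m≤2s ⟩
  10 * (2 * s)           ≡⟨ *-assoc 10 2 s ⟨
  20 * s                 ∎
  where
  open ≤-Reasoning
  slack : ∀ k → 10 * suc k ≡ 2 * suc (suc k) + (8 * k + 6)
  slack = solve-∀
  2[1+m]≤10m : 2 * suc m ≤ 10 * m
  2[1+m]≤10m = subst (2 * suc m ≤_) (sym (slack k)) (m≤m+n _ (8 * k + 6))

∈⇒0<length : ∀ {X : Set} {x : X} {xs} → x ∈ xs → 0 < length xs
∈⇒0<length (here _)  = z<s
∈⇒0<length (there _) = z<s

length-cartesianProduct : ∀ {X Y : Set} (xs : List X) (ys : List Y) →
  length (cartesianProduct xs ys) ≡ length xs * length ys
length-cartesianProduct []       ys = refl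
length-cartesianProduct (x ∷ xs) ys = trans (length-++ (map (x ,_) ys))
  (cong₂ _+_ (length-map (x ,_) ys) (length-cartesianProduct xs ys))

any≡true : ∀ {X : Set} {p : X → Bool.Bool} {x xs} → x ∈ xs → p x ≡ true → any p xs ≡ true
any≡true {p = p} x∈xs px≡true =
  Equivalence.to T-≡ (any⁺ p (lose x∈xs (Equivalence.from T-≡ px≡true)))

private
  variable
    X Y : Set

∑ : List X → (X → ℕ) → ℕ
∑ []       f = 0
∑ (x ∷ xs) f = f x + ∑ xs f

syntax ∑ xs (λ x → e) = ∑[ x ← xs ] e

∑-cong : ∀ (xs : List X) {f g : X → ℕ} → (∀ x → f x ≡ g x) → ∑ xs f ≡ ∑ xs g
∑-cong []       f≗g = refl
∑-cong (x ∷ xs) f≗g = cong₂ _+_ (f≗g x) (∑-cong xs f≗g)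

∑-mono-≤ : ∀ (xs : List X) {f g : X → ℕ} → (∀ x → f x ≤ g x) → ∑ xs f ≤ ∑ xs g
∑-mono-≤ []       f≤g = z≤n
∑-mono-≤ (x ∷ xs) f≤g = +-mono-≤ (f≤g x) (∑-mono-≤ xs f≤g)

∑-distrib-+ : ∀ (xs : List X) (f g : X → ℕ) → ∑[ x ← xs ] (f x + g x) ≡ ∑ xs f + ∑ xs g
∑-distrib-+ []       f g = refl
∑-distrib-+ (x ∷ xs) f g = trans (cong (f x + g x +_) (∑-distrib-+ xs f g))
                                 (interchange (f x) (g x) (∑ xs f) (∑ xs g))
  where
  interchange : ∀ a b c d → (a + b) + (c + d) ≡ (a + c) + (b + d)
  interchange = solve-∀

∑-*ˡ : ∀ (xs : List X) c (f : X → ℕ) → ∑[ x ← xs ] (c * f x) ≡ c * ∑ xs f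
∑-*ˡ []       c f = sym (*-zeroʳ c)
∑-*ˡ (x ∷ xs) c f =
  trans (cong (c * f x +_) (∑-*ˡ xs c f)) (sym (*-distribˡ-+ c (f x) (∑ xs f)))

∑-*ʳ : ∀ (xs : List X) c (f : X → ℕ) → ∑[ x ← xs ] (f x * c) ≡ ∑ xs f * c
∑-*ʳ xs c f = trans (∑-cong xs (λ x → *-comm (f x) c)) (trans (∑-*ˡ xs c f) (*-comm c _))

∑-const : ∀ (xs : List X) c → ∑[ _ ← xs ] c ≡ length xs * c
∑-const []       c = refl
∑-const (x ∷ xs) c = cong (c +_) (∑-const xs c)

∑-comm : ∀ (xs : List X) (ys : List Y) (f : X → Y → ℕ) →
  ∑[ x ← xs ] ∑[ y ← ys ] f x y ≡ ∑[ y ← ys ] ∑[ x ← xs ] f x y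
∑-comm []       ys f = sym (trans (∑-const ys 0) (*-zeroʳ (length ys)))
∑-comm (x ∷ xs) ys f =
  trans (cong (∑ ys (f x) +_) (∑-comm xs ys f)) (sym (∑-distrib-+ ys (f x) _))

0<∑⇒∃0< : ∀ (xs : List X) (f : X → ℕ) → 0 < ∑ xs f → ∃ λ x → x ∈ xs × 0 < f x
0<∑⇒∃0< (x ∷ xs) f 0<∑ with f x in fx≡
... | suc _ = x , here refl , subst (0 <_) (sym fx≡) z<s
... | zero  with 0<∑⇒∃0< xs f 0<∑
...   | y , y∈xs , 0<fy = y , there y∈xs , 0<fy

∃-below-average : ∀ (xs : List X) (f : X → ℕ) → 0 < length xs →
  ∃ λ x → x ∈ xs × length xs * f x ≤ ∑ xs f
∃-below-average (x ∷ [])         f _ = x , here refl , ≤-refl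
∃-below-average (x ∷ xs@(_ ∷ _)) f _ with ∃-below-average xs f z<s
... | y , y∈xs , avg with f x ≤? f y
...   | yes fx≤fy =
  x , here refl , +-monoʳ-≤ (f x) (≤-trans (*-monoʳ-≤ (length xs) fx≤fy) avg)
...   | no  fx≰fy = y , there y∈xs , +-mono-≤ (<⇒≤ (≰⇒> fx≰fy)) avg

∑-Cauchy-Schwarz : ∀ (xs : List X) (f g : X → ℕ) →
  ∑[ x ← xs ] (f x * g x) * ∑[ x ← xs ] (f x * g x) ≤
  ∑[ x ← xs ] (f x * f x) * ∑[ x ← xs ] (g x * g x)
∑-Cauchy-Schwarz []       f g = z≤n
∑-Cauchy-Schwarz (x ∷ xs) f g = begin
  (a * b + T) * (a * b + T)                          ≡⟨ expand a b T ⟩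
  a * b * (a * b) + 2 * (a * b * T) + T * T          ≤⟨ +-mono-≤ (+-monoʳ-≤ (a * b * (a * b)) cross)
                                                                 (∑-Cauchy-Schwarz xs f g) ⟩
  a * b * (a * b) + (a * a * G + b * b * F) + F * G  ≡⟨ factor a b F G ⟩
  (a * a + F) * (b * b + G)                          ∎
  where
  open ≤-Reasoning
  a = f x
  b = g x
  T = ∑[ y ← xs ] (f y * g y)
  F = ∑[ y ← xs ] (f y * f y)
  G = ∑[ y ← xs ] (g y * g y)
  expand : ∀ a b T → (a * b + T) * (a * b + T) ≡ a * b * (a * b) + 2 * (a * b * T) + T * T
  expand = solve-∀
  factor : ∀ a b F G →
    a * b * (a * b) + (a * a * G + b * b * F) + F * G ≡ (a * a + F) * (b * b + G)
  factor = solve-∀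
  regroup : ∀ a b u v → 2 * (a * b) * (u * v) ≡ 2 * ((a * v) * (b * u))
  regroup = solve-∀
  square : ∀ a u → (a * u) * (a * u) ≡ a * a * (u * u)
  square = solve-∀
  cross : 2 * (a * b * T) ≤ a * a * G + b * b * F
  cross = begin
    2 * (a * b * T)                            ≡⟨ *-assoc 2 (a * b) T ⟨
    2 * (a * b) * T                            ≡⟨ ∑-*ˡ xs (2 * (a * b)) _ ⟨
    ∑[ y ← xs ] (2 * (a * b) * (f y * g y))    ≡⟨ ∑-cong xs (λ y → regroup a b (f y) (g y)) ⟩
    ∑[ y ← xs ] (2 * ((a * g y) * (b * f y)))  ≤⟨ ∑-mono-≤ xs (λ y → 2mn≤m²+n² (a * g y) (b * f y)) ⟩
    ∑[ y ← xs ] ((a * g y) * (a * g y) + (b * f y) * (b * f y))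
      ≡⟨ ∑-distrib-+ xs _ _ ⟩
    ∑[ y ← xs ] ((a * g y) * (a * g y)) + ∑[ y ← xs ] ((b * f y) * (b * f y))
      ≡⟨ cong₂ _+_ (trans (∑-cong xs (λ y → square a (g y))) (∑-*ˡ xs (a * a) _))
                   (trans (∑-cong xs (λ y → square b (f y))) (∑-*ˡ xs (b * b) _)) ⟩
    a * a * G + b * b * F                      ∎

module _ {p} {P : Pred X p} (P? : Decidable P) where

  length-filter≡∑𝟙 : ∀ (xs : List X) → length (filter P? xs) ≡ ∑[ x ← xs ] 𝟙 (P? x)
  length-filter≡∑𝟙 []       = refl
  length-filter≡∑𝟙 (x ∷ xs) with P? x
  ... | yes _ = cong suc (length-filter≡∑𝟙 xs)
  ... | no  _ = length-filter≡∑𝟙 xs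

  ∑𝟙≤length : ∀ (xs : List X) → ∑[ x ← xs ] 𝟙 (P? x) ≤ length xs
  ∑𝟙≤length xs =
    ≤-trans (∑-mono-≤ xs (𝟙≤1 ∘ P?)) (≤-reflexive (trans (∑-const xs 1) (*-identityʳ _)))

  ∑𝟙≡0 : ∀ {xs : List X} → All (¬_ ∘ P) xs → ∑[ x ← xs ] 𝟙 (P? x) ≡ 0
  ∑𝟙≡0 []                   = refl
  ∑𝟙≡0 (_∷_ {x} ¬Px ¬P[xs]) with P? x
  ... | yes Px = contradiction Px ¬Px
  ... | no  _  = ∑𝟙≡0 ¬P[xs]

  ∑𝟙≤1 : ∀ {xs : List X} → Unique xs → (∀ {x y} → P x → P y → x ≡ y) →
    ∑[ x ← xs ] 𝟙 (P? x) ≤ 1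
  ∑𝟙≤1 []                           P-unique = z≤n
  ∑𝟙≤1 (_∷_ {x} x∉xs xs-unique) P-unique with P? x
  ... | no  _  = ∑𝟙≤1 xs-unique P-unique
  ... | yes Px = ≤-reflexive (cong suc (∑𝟙≡0 (All.map (λ x≢y Py → x≢y (P-unique Px Py)) x∉xs)))

module _ (_≟_ : DecidableEquality X) where

  ∑-select-∉ : ∀ {x} {xs : List X} (h : X → ℕ) → x ∉ xs →
    ∑[ s ← xs ] (𝟙 (s ≟ x) * h s) ≡ 0
  ∑-select-∉     {xs = []}     h x∉xs = refl
  ∑-select-∉ {x} {xs = y ∷ xs} h x∉xs with y ≟ x
  ... | yes refl = contradiction (here refl) x∉xs
  ... | no  _    = ∑-select-∉ h (x∉xs ∘ there)

  ∑-select : ∀ {x} {xs : List X} (h : X → ℕ) → Unique xs → x ∈ xs →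
    ∑[ s ← xs ] (𝟙 (s ≟ x) * h s) ≡ h x
  ∑-select {x} {y ∷ xs} h (y∉xs ∷ xs-unique) x∈ with y ≟ x
  ... | yes refl =
    trans (cong₂ _+_ (+-identityʳ (h y)) (∑-select-∉ h (All¬⇒¬Any y∉xs))) (+-identityʳ (h y))
  ... | no  y≢x with x∈
  ...   | here x≡y   = contradiction (sym x≡y) y≢x
  ...   | there x∈xs = ∑-select h xs-unique x∈xs

module Representation {Z : Set} (_≟_ : DecidableEquality Z) {P : Set} (ps : List P) where

  rep : (P → Z) → Z → ℕ
  rep g s = ∑[ p ← ps ] 𝟙 (s ≟ g p)

  energy : (P → Z) → ℕ
  energy g = ∑[ p ← ps ] rep g (g p)

  0<rep⇒∈image : ∀ g {s} → 0 < rep g s → ∃ λ p → p ∈ ps × s ≡ g p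
  0<rep⇒∈image g {s} 0<rep with 0<∑⇒∃0< ps _ 0<rep
  ... | p , p∈ps , 0<𝟙 = p , p∈ps , 0<𝟙⇒ (s ≟ g p) 0<𝟙

  ∑-energy≤ : DecidableEquality P → Unique ps → ∀ {Ξ : Set} {ξs : List Ξ} → Unique ξs →
    (g : Ξ → P → Z) → (∀ {p q ξ η} → g ξ p ≡ g ξ q → g η p ≡ g η q → p ≡ q ⊎ ξ ≡ η) →
    ∑[ ξ ← ξs ] energy (g ξ) ≤ length ps * (length ξs + length ps)
  ∑-energy≤ _≟ᴾ_ ps-unique {ξs = ξs} ξs-unique g collide-once = begin
    ∑[ ξ ← ξs ] ∑[ p ← ps ] ∑[ q ← ps ] 𝟙 (g ξ p ≟ g ξ q)  ≡⟨ ∑-comm ξs ps _ ⟩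
    ∑[ p ← ps ] ∑[ ξ ← ξs ] ∑[ q ← ps ] 𝟙 (g ξ p ≟ g ξ q)  ≡⟨ ∑-cong ps (λ p → ∑-comm ξs ps _) ⟩
    ∑[ p ← ps ] ∑[ q ← ps ] ∑[ ξ ← ξs ] 𝟙 (g ξ p ≟ g ξ q)
      ≤⟨ ∑-mono-≤ ps (λ p → ∑-mono-≤ ps (collisions≤ p)) ⟩
    ∑[ p ← ps ] ∑[ q ← ps ] (𝟙 (q ≟ᴾ p) * m + 1)           ≤⟨ ∑-mono-≤ ps per-point ⟩
    ∑[ p ← ps ] (m + length ps)                            ≡⟨ ∑-const ps _ ⟩
    length ps * (m + length ps)                            ∎
    where
    open ≤-Reasoning
    m = length ξs
    collisions≤ : ∀ p q → ∑[ ξ ← ξs ] 𝟙 (g ξ p ≟ g ξ q) ≤ 𝟙 (q ≟ᴾ p) * m + 1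
    collisions≤ p q with q ≟ᴾ p
    ... | yes _   = ≤-trans (∑𝟙≤length _ ξs) (≤-trans (m≤m+n m 0) (m≤m+n _ 1))
    ... | no  q≢p = ∑𝟙≤1 _ ξs-unique λ e₁ e₂ →
      fromInj₂ (λ p≡q → contradiction (sym p≡q) q≢p) (collide-once e₁ e₂)
    per-point : ∀ p → ∑[ q ← ps ] (𝟙 (q ≟ᴾ p) * m + 1) ≤ m + length ps
    per-point p = begin
      ∑[ q ← ps ] (𝟙 (q ≟ᴾ p) * m + 1)
        ≡⟨ ∑-distrib-+ ps _ _ ⟩
      ∑[ q ← ps ] (𝟙 (q ≟ᴾ p) * m) + ∑[ _ ← ps ] 1
        ≡⟨ cong₂ _+_ (∑-*ʳ ps m _) (trans (∑-const ps 1) (*-identityʳ _)) ⟩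
      ∑[ q ← ps ] 𝟙 (q ≟ᴾ p) * m + length ps
        ≤⟨ +-monoˡ-≤ _ (*-monoˡ-≤ m (∑𝟙≤1 (_≟ᴾ p) ps-unique (λ e₁ e₂ → trans e₁ (sym e₂)))) ⟩
      1 * m + length ps
        ≡⟨ cong (_+ length ps) (*-identityˡ m) ⟩
      m + length ps
        ∎

  module _ {L : List Z} (L-complete : ∀ z → z ∈ L) (L-unique : Unique L) where

    ∑-δ : ∀ z (h : Z → ℕ) → ∑[ s ← L ] (𝟙 (s ≟ z) * h s) ≡ h z
    ∑-δ z h = ∑-select _≟_ h L-unique (L-complete z)

    ∑-rep : ∀ g → ∑[ s ← L ] rep g s ≡ length ps
    ∑-rep g = begin
      ∑[ s ← L ] ∑[ p ← ps ] 𝟙 (s ≟ g p)        ≡⟨ ∑-comm L ps _ ⟩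
      ∑[ p ← ps ] ∑[ s ← L ] 𝟙 (s ≟ g p)        ≡⟨ ∑-cong ps (λ p → ∑-cong L (λ s → *-identityʳ _)) ⟨
      ∑[ p ← ps ] ∑[ s ← L ] (𝟙 (s ≟ g p) * 1)  ≡⟨ ∑-cong ps (λ p → ∑-δ (g p) (λ _ → 1)) ⟩
      ∑[ p ← ps ] 1                             ≡⟨ ∑-const ps 1 ⟩
      length ps * 1                             ≡⟨ *-identityʳ _ ⟩
      length ps                                 ∎
      where open ≡-Reasoning

    ∑-rep² : ∀ g → ∑[ s ← L ] (rep g s * rep g s) ≡ energy g
    ∑-rep² g = begin
      ∑[ s ← L ] (rep g s * rep g s)                  ≡⟨ ∑-cong L (λ s → ∑-*ʳ ps (rep g s) _) ⟨
      ∑[ s ← L ] ∑[ p ← ps ] (𝟙 (s ≟ g p) * rep g s)  ≡⟨ ∑-comm L ps _ ⟩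
      ∑[ p ← ps ] ∑[ s ← L ] (𝟙 (s ≟ g p) * rep g s)  ≡⟨ ∑-cong ps (λ p → ∑-δ (g p) (rep g)) ⟩
      energy g                                        ∎
      where open ≡-Reasoning

    length²≤support*energy : ∀ g → length ps * length ps ≤ ∑[ s ← L ] sgn (rep g s) * energy g
    length²≤support*energy g =
      subst₂ _≤_ (cong₂ _*_ ∑sgn*rep ∑sgn*rep) (cong₂ _*_ ∑sgn² (∑-rep² g))
        (∑-Cauchy-Schwarz L (sgn ∘ rep g) (rep g))
      where
      ∑sgn*rep : ∑[ s ← L ] (sgn (rep g s) * rep g s) ≡ length ps
      ∑sgn*rep = trans (∑-cong L (sgn[n]*n≡n ∘ rep g)) (∑-rep g)
      ∑sgn² : ∑[ s ← L ] (sgn (rep g s) * sgn (rep g s)) ≡ ∑[ s ← L ] sgn (rep g s)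
      ∑sgn² = ∑-cong L (sgn[n]*sgn[n]≡sgn[n] ∘ rep g)

module AffineCollisions (F : FiniteField) where
  open FiniteField F
  module R = IsCommutativeRing isCommutativeRing
  open R using (_-_)

  commutativeRing : CommutativeRing _ _
  commutativeRing = record { isCommutativeRing = isCommutativeRing }

  open CommutativeRing commutativeRing using (+-group; ring)
  open GroupProperties +-group using (∙-cancelʳ; x∙y⁻¹≈ε⇒x≈y; y≈x\\z; x≈z//y)
  open RingProperties ring using (-‿distribˡ-*)

  *-cancelˡ : ∀ {u x y} → ¬ u ≡ 0F → u *F x ≡ u *F y → x ≡ y
  *-cancelˡ {u} {x} {y} u≢0 ux≡uy = begin
    x              ≡⟨ R.*-identityˡ x ⟨
    1F *F x        ≡⟨ cong (_*F x) vu≡1 ⟨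
    (v *F u) *F x  ≡⟨ R.*-assoc v u x ⟩
    v *F (u *F x)  ≡⟨ cong (v *F_) ux≡uy ⟩
    v *F (u *F y)  ≡⟨ R.*-assoc v u y ⟨
    (v *F u) *F y  ≡⟨ cong (_*F y) vu≡1 ⟩
    1F *F y        ≡⟨ R.*-identityˡ y ⟩
    y              ∎
    where
    open ≡-Reasoning
    v = proj₁ (inverse u u≢0)
    vu≡1 : v *F u ≡ 1F
    vu≡1 = trans (R.*-comm v u) (proj₂ (inverse u u≢0))

  collision⇒linear : ∀ {a b a′ b′ ξ} → a +F b *F ξ ≡ a′ +F b′ *F ξ → (b - b′) *F ξ ≡ a′ - a
  collision⇒linear {a} {b} {a′} {b′} {ξ} e = begin
    (b - b′) *F ξ                        ≡⟨ R.distribʳ ξ b (-F b′) ⟩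
    b *F ξ +F (-F b′) *F ξ               ≡⟨ cong (b *F ξ +F_) (-‿distribˡ-* b′ ξ) ⟨
    b *F ξ - b′ *F ξ                     ≡⟨ cong (_- b′ *F ξ) (y≈x\\z a (b *F ξ) _ e) ⟩
    (-F a +F (a′ +F b′ *F ξ)) - b′ *F ξ  ≡⟨ cong (_- b′ *F ξ) (R.+-assoc (-F a) a′ _) ⟨
    (-F a +F a′ +F b′ *F ξ) - b′ *F ξ    ≡⟨ x≈z//y (-F a +F a′) (b′ *F ξ) _ refl ⟨
    -F a +F a′                           ≡⟨ R.+-comm (-F a) a′ ⟩
    a′ - a                               ∎
    where open ≡-Reasoning

  affine-collision : ∀ {a b a′ b′ ξ η} →
    a +F b *F ξ ≡ a′ +F b′ *F ξ → a +F b *F η ≡ a′ +F b′ *F η → (a , b) ≡ (a′ , b′) ⊎ ξ ≡ η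
  affine-collision {a} {b} {a′} {b′} {ξ} e₁ e₂ with b ≟ b′
  ... | yes refl = inj₁ (cong (_, b) (∙-cancelʳ (b *F ξ) a a′ e₁))
  ... | no  b≢b′ = inj₂ (*-cancelˡ (b≢b′ ∘ x∙y⁻¹≈ε⇒x≈y b b′)
                          (trans (collision⇒linear e₁) (sym (collision⇒linear e₂))))

module Dilations (F : FiniteField) where
  open FiniteField F
  open AffineCollisions F using (affine-collision)

  elems-complete : ∀ x → x ∈ elems
  elems-complete x = subst (_∈ elems) (Inverse.strictlyInverseˡ enum x)
    (∈-map⁺ (Inverse.to enum) (∈-allFin (Inverse.from enum x)))

  elems-unique : Unique elems
  elems-unique = map⁺ (Injection.injective (↔⇒↣ enum)) (allFin⁺ size)

  length-elems : length elems ≡ size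
  length-elems = trans (length-map (Inverse.to enum) (allFin size)) (length-tabulate _)

  members : Subset → List Carrier
  members S = filter (λ x → S x Bool.≟ true) elems

  nonzero : List Carrier
  nonzero = filter (λ ξ → ¬? (ξ ≟ 0F)) elems

  0<∣nonzero∣ : 0 < length nonzero
  0<∣nonzero∣ = ∈⇒0<length (∈-filter⁺ (λ ξ → ¬? (ξ ≟ 0F)) (elems-complete 1F) (0≢1 ∘ sym))

  size≡1+∣nonzero∣ : size ≡ suc (length nonzero)
  size≡1+∣nonzero∣ = begin
    size                                                ≡⟨ length-elems ⟨
    length elems                                        ≡⟨ *-identityʳ _ ⟨
    length elems * 1                                    ≡⟨ ∑-const elems 1 ⟨
    ∑[ x ← elems ] 1                                    ≡⟨ ∑-cong elems split ⟩
    ∑[ x ← elems ] (𝟙 (x ≟ 0F) * 1 + 𝟙 (¬? (x ≟ 0F)))  ≡⟨ ∑-distrib-+ elems _ _ ⟩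
    ∑[ x ← elems ] (𝟙 (x ≟ 0F) * 1) + ∑[ x ← elems ] 𝟙 (¬? (x ≟ 0F))
      ≡⟨ cong₂ _+_ (∑-select _≟_ _ elems-unique (elems-complete 0F))
                   (sym (length-filter≡∑𝟙 _ elems)) ⟩
    1 + length nonzero                                  ∎
    where
    open ≡-Reasoning
    split : ∀ x → 1 ≡ 𝟙 (x ≟ 0F) * 1 + 𝟙 (¬? (x ≟ 0F))
    split x with x ≟ 0F
    ... | yes _ = refl
    ... | no  _ = refl

  dilate : Carrier → Carrier × Carrier → Carrier
  dilate ξ (a , b) = a +F b *F ξ

  module _ (A B : Subset) where

    pairs : List (Carrier × Carrier)
    pairs = cartesianProduct (members A) (members B)

    open Representation _≟_ pairs

    length-pairs : length pairs ≡ ∣ A ∣ * ∣ B ∣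
    length-pairs = length-cartesianProduct (members A) (members B)

    pairs-unique : Unique pairs
    pairs-unique = cartesianProduct⁺ (filter⁺ _ elems-unique) (filter⁺ _ elems-unique)

    dilate∈sumDil : ∀ {a b} ξ → a ∈ members A → b ∈ members B →
      sumDil A B ξ (dilate ξ (a , b)) ≡ true
    dilate∈sumDil {a} {b} ξ a∈A b∈B =
      any≡true (elems-complete a) (any≡true (elems-complete b) a,b-witness)
      where
      a,b-witness : A a ∧ B b ∧ does (dilate ξ (a , b) ≟ dilate ξ (a , b)) ≡ true
      a,b-witness rewrite proj₂ (∈-filter⁻ (λ x → A x Bool.≟ true) {xs = elems} a∈A)
                        | proj₂ (∈-filter⁻ (λ x → B x Bool.≟ true) {xs = elems} b∈B) =
        dec-true (_ ≟ _) refl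

    support≤∣sumDil∣ : ∀ ξ → ∑[ s ← elems ] sgn (rep (dilate ξ) s) ≤ ∣ sumDil A B ξ ∣
    support≤∣sumDil∣ ξ =
      ≤-trans (∑-mono-≤ elems sgn≤𝟙) (≤-reflexive (sym (length-filter≡∑𝟙 _ elems)))
      where
      sgn≤𝟙 : ∀ s → sgn (rep (dilate ξ) s) ≤ 𝟙 (sumDil A B ξ s Bool.≟ true)
      sgn≤𝟙 s with rep (dilate ξ) s in rep≡ | sumDil A B ξ s Bool.≟ true
      ... | zero  | _        = z≤n
      ... | suc _ | yes _    = ≤-refl
      ... | suc _ | no  s∉AB with 0<rep⇒∈image (dilate ξ) (subst (0 <_) (sym rep≡) z<s)
      ...   | (a , b) , ab∈pairs , refl = contradiction
        (uncurry (dilate∈sumDil ξ) (∈-cartesianProduct⁻ (members A) (members B) ab∈pairs)) s∉AB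

    [∣A∣∣B∣]²≤∣A+Bξ∣*energy : ∀ ξ →
      (∣ A ∣ * ∣ B ∣) * (∣ A ∣ * ∣ B ∣) ≤ ∣ sumDil A B ξ ∣ * energy (dilate ξ)
    [∣A∣∣B∣]²≤∣A+Bξ∣*energy ξ =
      subst (_≤ ∣ sumDil A B ξ ∣ * energy (dilate ξ)) (cong₂ _*_ length-pairs length-pairs)
        (≤-trans (length²≤support*energy elems-complete elems-unique (dilate ξ))
                 (*-monoˡ-≤ (energy (dilate ξ)) (support≤∣sumDil∣ ξ)))

    ∃-small-energy : ∃ λ ξ → ξ ∈ nonzero ×
      length nonzero * energy (dilate ξ) ≤ (∣ A ∣ * ∣ B ∣) * (length nonzero + ∣ A ∣ * ∣ B ∣)
    ∃-small-energy with ∃-below-average nonzero (energy ∘ dilate) 0<∣nonzero∣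
    ... | ξ , ξ∈nonzero , below-average = ξ , ξ∈nonzero , ≤-trans below-average
      (subst (λ N → ∑[ η ← nonzero ] energy (dilate η) ≤ N * (length nonzero + N)) length-pairs
        (∑-energy≤ (≡-dec _≟_ _≟_) pairs-unique (filter⁺ _ elems-unique) dilate affine-collision))

lemma2p1 : (F : FiniteField) → let open FiniteField F in
    (A B : Subset) → NonEmpty A → NonEmpty B →
    ∃ λ ξ → ¬ (ξ ≡ 0F) × ((10 * (∣ A ∣ * ∣ B ∣)) ⊓ (2 * size) ≤ 20 * ∣ sumDil A B ξ ∣)
lemma2p1 F A B _ _ =
  let open FiniteField F
      open Dilations F
      ξ , ξ∈nonzero , small-energy = ∃-small-energy A B
      N = ∣ A ∣ * ∣ B ∣
      m = length nonzero
      s = ∣ sumDil A B ξ ∣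
      mN≤s[m+N] : m * N ≤ s * (m + N)
      mN≤s[m+N] = n²≤se⇒me≤n[m+n]⇒mn≤s[m+n] N m s ([∣A∣∣B∣]²≤∣A+Bξ∣*energy A B ξ) small-energy
      N⊓m≤2s : N ⊓ m ≤ 2 * s
      N⊓m≤2s = mn≤s[m+n]⇒n⊓m≤2s N m s mN≤s[m+N]
  in  ξ , proj₂ (∈-filter⁻ (λ ξ → ¬? (ξ ≟ 0F)) {xs = elems} ξ∈nonzero) ,
      subst (λ q → (10 * N) ⊓ (2 * q) ≤ 20 * s) (sym size≡1+∣nonzero∣)
        (n⊓m≤2s⇒10n⊓2[1+m]≤20s N m s 0<∣nonzero∣ N⊓m≤2s)
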